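{- Let $G$ be a finite simple graph, let $u$ be a universal vertex of $G$, and let $k$ be a positive integer. Then $\gamma_{\times k}(G)=\gamma_{\times (k-1)}(G-u)+1$.
   Context: A vertex $v$ is universal if $N_G[v]=V(G)$, where $N_G[v]=N_G(v)\cup\{v\}$. $G-u$ is the subgraph induced by $V(G)\setminus\{u\}$. For a nonnegative integer $k$, $D\subseteq V(G)$ is a $k$-tuple dominating set if $|N_G[v]\cap D|\geq k$ for all $v\in V(G)$; $\gamma_{\times k}(G)$ is the minimum size of such a set when $k\le\delta(G)+1$ and $+\infty$ otherwise (with $+\infty+1=+\infty$); $\gamma_{\times 0}(G)=0$. For a disconnected graph, $\gamma_{\times k}$ is the sum of the values over its connected components. -}

module Defs where

open import Data.Nat using (ℕ; zero; suc; _≤_; _≤?_; _⊓_; _+_)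
open import Data.Fin using (Fin; punchIn; _≟_)
open import Data.Fin.Properties using (all?)
open import Data.Fin.Subset using (Subset; ∣_∣; _∩_; inside; outside)
open import Data.Vec using ([]; _∷_; tabulate)
open import Data.List using (List; []; _∷_; _++_; map; filter; foldr)
open import Data.Bool using (_∨_)
open import Data.Maybe using (Maybe; just; nothing)
open import Relation.Nullary using (¬_; yes; no)
open import Relation.Nullary.Decidable using (⌊_⌋)
open import Relation.Binary using (Decidable)
open import Relation.Binary.PropositionalEquality using (_≡_; _≢_)

record Graph (n : ℕ) : Set₁ where
  field
    Adj   : Fin n → Fin n → Set
    adj?  : Decidable Adj
    sym   : ∀ {v w} → Adj v w → Adj w v
    irrefl : ∀ {v} → ¬ Adj v v
open Graph public

N : ∀ {n} → Graph n → Fin n → Subset n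
N G v = tabulate λ w → ⌊ adj? G v w ⌋

N[_] : ∀ {n} → Graph n → Fin n → Subset n
N[ G ] v = tabulate λ w → ⌊ w ≟ v ⌋ ∨ ⌊ adj? G v w ⌋

deg : ∀ {n} → Graph n → Fin n → ℕ
deg G v = ∣ N G v ∣

Universal : ∀ {n} → Graph n → Fin n → Set
Universal G u = ∀ v → v ≢ u → Adj G u v

-- G - u : subgraph induced by V(G) \ {u}; vertex i of G - u is punchIn u i.
_─_ : ∀ {n} → Graph (suc n) → Fin (suc n) → Graph n
G ─ u = record
  { Adj = λ i j → Adj G (punchIn u i) (punchIn u j)
  ; adj? = λ i j → adj? G (punchIn u i) (punchIn u j)
  ; sym = sym G
  ; irrefl = irrefl G
  }

IsKTupleDom : ∀ {n} → Graph n → ℕ → Subset n → Set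
IsKTupleDom {n} G k D = ∀ (v : Fin n) → k ≤ ∣ N[ G ] v ∩ D ∣

isKTupleDom? : ∀ {n} (G : Graph n) (k : ℕ) (D : Subset n) → Relation.Nullary.Dec (IsKTupleDom G k D)
isKTupleDom? G k D = all? λ v → k ≤? ∣ N[ G ] v ∩ D ∣

subsets : ∀ n → List (Subset n)
subsets zero = [] ∷ []
subsets (suc n) = map (outside ∷_) (subsets n) ++ map (inside ∷_) (subsets n)

-- Admissibility condition "k ≤ δ(G) + 1", written pointwise: every vertex has
-- degree at least k - 1.
Admissible : ∀ {n} → Graph n → ℕ → Set
Admissible {n} G k = ∀ (v : Fin n) → k ≤ suc (deg G v)

-- γ_{×k}(G), with nothing representing +∞.
-- When admissible, it is the minimum of |D| over all k-tuple dominating sets D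
-- (the whole vertex set, of size n, is always one, so n is a safe initial value).
-- Convention for the null graph K₀: γ_{×0}(K₀) = 0 and
-- γ_{×k}(K₀) = +∞ for k ≥ 1 (i.e. δ(K₀) + 1 = 0).
γ× : ∀ {n} → Graph n → ℕ → Maybe ℕ
γ× {zero} G zero = just 0
γ× {zero} G (suc k) = nothing
γ× {suc n} G k with all? (λ v → k ≤? suc (deg G v))
... | yes _ = just (foldr (λ D acc → ∣ D ∣ ⊓ acc) (suc n) (filter (isKTupleDom? G k) (subsets (suc n))))
... | no _ = nothing

_+∞1 : Maybe ℕ → Maybe ℕ
just m +∞1 = just (suc m)
nothing +∞1 = nothing

module Submission where

-- Every closed neighbourhood of G contains the universal vertex u, so adding u to a
-- (k-1)-tuple dominating set of G - u gives a k-tuple dominating set of G.  Conversely a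
-- k-tuple dominating set D of G loses exactly one vertex on passing to G - u: if u ∈ D
-- remove u, and if u ∉ D then D already k-tuple dominates G - u, so remove any vertex.
-- Since deg_G v = deg_{G-u} v + 1 for v ≠ u and deg_G u = |G| - 1, the two admissibility
-- conditions k ≤ δ + 1 agree as well.

open import Defs hiding (sym)
open import Data.Nat using (ℕ; zero; suc; _≤_; _<_; _∸_; _⊓_; _≤?_; z≤n; s≤s)
open import Data.Nat.Properties
  using (module ≤-Reasoning; ≤-refl; ≤-trans; ≤-reflexive; ≤-antisym; ≤-pred; n≤1+n; m⊓n≤m; m⊓n≤n; ⊓-sel; n≮0)
open import Data.Fin using (Fin; zero; suc; punchIn; punchOut; _≟_)
open import Data.Fin.Properties using (all?; punchInᵢ≢i; punchIn-injective; punchIn-punchOut)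
open import Data.Fin.Subset using (Subset; ∣_∣; _∩_; inside; outside; ⊤)
open import Data.Fin.Subset.Properties using (∣p∣≤n; ∣p∣≤∣x∷p∣; ∣p∩q∣≤∣q∣; ∣⊤∣≡n; ∩-identityˡ)
open import Data.Vec using (Vec; []; _∷_; lookup; tabulate; removeAt; insertAt; zipWith; _[_]≔_)
open import Data.Vec.Properties
  using (lookup∘tabulate; tabulate∘lookup; tabulate-cong; lookup-replicate; insertAt-lookup;
         insertAt-punchIn; insertAt-removeAt; removeAt-insertAt; lookup∘update; lookup∘update′; lookup-zipWith)
open import Data.List using (List; []; _∷_; filter; foldr)
open import Data.List.Membership.Propositional using (_∈_)
open import Data.List.Membership.Propositional.Properties using (∈-filter⁺; ∈-filter⁻; ∈-++⁺ˡ; ∈-++⁺ʳ; ∈-map⁺)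
open import Data.List.Relation.Unary.Any using (here; there)
open import Data.Bool using (true; false; _∧_; _∨_)
open import Data.Bool.Properties using (∨-zeroʳ)
open import Data.Maybe using (just; nothing)
open import Data.Product using (∃; _×_; _,_; proj₂)
open import Data.Sum using (_⊎_; inj₁; inj₂; map)
open import Data.Empty using (⊥-elim)
open import Function using (_∘_; _⇔_; mk⇔)
open import Relation.Nullary using (¬_; Dec; yes; no)
open import Relation.Nullary.Decidable using (⌊_⌋; isYes≗does; dec-true; dec-false; does-⇔)
open import Relation.Binary.PropositionalEquality
  using (_≡_; refl; sym; trans; cong; cong₂; subst; module ≡-Reasoning)

private
  variable
    A : Set
    n m k : ℕ

⌊⌋-true : {P : Set} (p? : Dec P) → P → ⌊ p? ⌋ ≡ true
⌊⌋-true p? p = trans (isYes≗does p?) (dec-true p? p)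

⌊⌋-false : {P : Set} (p? : Dec P) → ¬ P → ⌊ p? ⌋ ≡ false
⌊⌋-false p? ¬p = trans (isYes≗does p?) (dec-false p? ¬p)

⌊⌋-⇔ : {P Q : Set} → P ⇔ Q → (p? : Dec P) (q? : Dec Q) → ⌊ p? ⌋ ≡ ⌊ q? ⌋
⌊⌋-⇔ P⇔Q p? q? = trans (isYes≗does p?) (trans (does-⇔ P⇔Q p? q?) (sym (isYes≗does q?)))

punchIn-elim : ∀ {P : Fin (suc n) → Set} (u : Fin (suc n)) →
               P u → (∀ i → P (punchIn u i)) → ∀ v → P v
punchIn-elim {P = P} u Pu Pi v with v ≟ u
... | yes refl = Pu
... | no v≢u   = subst P (punchIn-punchOut (v≢u ∘ sym)) (Pi (punchOut (v≢u ∘ sym)))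

lookup-ext : (xs ys : Vec A n) → (∀ i → lookup xs i ≡ lookup ys i) → xs ≡ ys
lookup-ext xs ys eq = begin
  xs                   ≡⟨ tabulate∘lookup xs ⟨
  tabulate (lookup xs) ≡⟨ tabulate-cong eq ⟩
  tabulate (lookup ys) ≡⟨ tabulate∘lookup ys ⟩
  ys                   ∎
  where open ≡-Reasoning

lookup-removeAt : ∀ (xs : Vec A (suc n)) i j → lookup (removeAt xs i) j ≡ lookup xs (punchIn i j)
lookup-removeAt xs i j = begin
  lookup (removeAt xs i) j                                        ≡⟨ insertAt-punchIn (removeAt xs i) i (lookup xs i) j ⟨
  lookup (insertAt (removeAt xs i) i (lookup xs i)) (punchIn i j) ≡⟨ cong (λ ys → lookup ys (punchIn i j)) (insertAt-removeAt xs i) ⟩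
  lookup xs (punchIn i j)                                         ∎
  where open ≡-Reasoning

removeAt-tabulate : ∀ (f : Fin (suc n) → A) i → removeAt (tabulate f) i ≡ tabulate (f ∘ punchIn i)
removeAt-tabulate f i = lookup-ext _ _ λ j →
  trans (lookup-removeAt (tabulate f) i j)
        (trans (lookup∘tabulate f (punchIn i j)) (sym (lookup∘tabulate (f ∘ punchIn i) j)))

removeAt-zipWith : ∀ {B C : Set} (f : A → B → C) (xs : Vec A (suc n)) ys i →
                   removeAt (zipWith f xs ys) i ≡ zipWith f (removeAt xs i) (removeAt ys i)
removeAt-zipWith f (x ∷ xs)      (y ∷ ys)      zero    = refl
removeAt-zipWith f (x ∷ x′ ∷ xs) (y ∷ y′ ∷ ys) (suc i) = cong (f x y ∷_) (removeAt-zipWith f (x′ ∷ xs) (y′ ∷ ys) i)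

removeAt-[]≔ : ∀ (xs : Vec A (suc n)) i y → removeAt (xs [ i ]≔ y) i ≡ removeAt xs i
removeAt-[]≔ xs i y = lookup-ext _ _ λ j →
  trans (lookup-removeAt (xs [ i ]≔ y) i j)
        (trans (lookup∘update′ (punchInᵢ≢i i j) xs y) (sym (lookup-removeAt xs i j)))

∣insertAt∣ : ∀ (p : Subset n) i x → ∣ insertAt p i x ∣ ≡ ∣ x ∷ p ∣
∣insertAt∣ p       zero    x       = refl
∣insertAt∣ (inside  ∷ p) (suc i) inside  = cong suc (∣insertAt∣ p i inside)
∣insertAt∣ (inside  ∷ p) (suc i) outside = cong suc (∣insertAt∣ p i outside)
∣insertAt∣ (outside ∷ p) (suc i) inside  = ∣insertAt∣ p i inside
∣insertAt∣ (outside ∷ p) (suc i) outside = ∣insertAt∣ p i outside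

∣p∣≡∣p[i]∷removeAt∣ : ∀ (p : Subset (suc n)) i → ∣ p ∣ ≡ ∣ lookup p i ∷ removeAt p i ∣
∣p∣≡∣p[i]∷removeAt∣ p i = begin
  ∣ p ∣                                      ≡⟨ cong ∣_∣ (insertAt-removeAt p i) ⟨
  ∣ insertAt (removeAt p i) i (lookup p i) ∣ ≡⟨ ∣insertAt∣ (removeAt p i) i (lookup p i) ⟩
  ∣ lookup p i ∷ removeAt p i ∣              ∎
  where open ≡-Reasoning

∣x∷p∣≤1+∣p∣ : ∀ x (p : Subset n) → ∣ x ∷ p ∣ ≤ suc ∣ p ∣
∣x∷p∣≤1+∣p∣ inside  p = ≤-refl
∣x∷p∣≤1+∣p∣ outside p = n≤1+n ∣ p ∣

removeAt-≡⇒∣p∣≤1+∣q∣ : ∀ (p q : Subset (suc n)) i → removeAt p i ≡ removeAt q i → ∣ p ∣ ≤ suc ∣ q ∣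
removeAt-≡⇒∣p∣≤1+∣q∣ p q i eq = begin
  ∣ p ∣                             ≡⟨ ∣p∣≡∣p[i]∷removeAt∣ p i ⟩
  ∣ lookup p i ∷ removeAt p i ∣     ≤⟨ ∣x∷p∣≤1+∣p∣ (lookup p i) (removeAt p i) ⟩
  suc ∣ removeAt p i ∣              ≡⟨ cong (suc ∘ ∣_∣) eq ⟩
  suc ∣ removeAt q i ∣              ≤⟨ s≤s (∣p∣≤∣x∷p∣ (lookup q i) (removeAt q i)) ⟩
  suc ∣ lookup q i ∷ removeAt q i ∣ ≡⟨ cong suc (∣p∣≡∣p[i]∷removeAt∣ q i) ⟨
  suc ∣ q ∣                         ∎
  where open ≤-Reasoning

∣p∣≡1+∣p[i]≔outside∣ : ∀ (p : Subset (suc n)) {i} → lookup p i ≡ inside → ∣ p ∣ ≡ suc ∣ p [ i ]≔ outside ∣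
∣p∣≡1+∣p[i]≔outside∣ p {i} i∈p = begin
  ∣ p ∣                               ≡⟨ ∣p∣≡∣p[i]∷removeAt∣ p i ⟩
  ∣ lookup p i ∷ removeAt p i ∣       ≡⟨ cong₂ (λ x r → ∣ x ∷ r ∣) i∈p (sym (removeAt-[]≔ p i outside)) ⟩
  suc ∣ removeAt p′ i ∣               ≡⟨ cong (λ x → suc ∣ x ∷ removeAt p′ i ∣) (lookup∘update i p outside) ⟨
  suc ∣ lookup p′ i ∷ removeAt p′ i ∣ ≡⟨ cong suc (∣p∣≡∣p[i]∷removeAt∣ p′ i) ⟨
  suc ∣ p′ ∣                          ∎
  where
  open ≡-Reasoning
  p′ = p [ i ]≔ outside

∣p∣>0⇒∃inside : ∀ (p : Subset n) → 0 < ∣ p ∣ → ∃ λ i → lookup p i ≡ inside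
∣p∣>0⇒∃inside (inside  ∷ p) _     = zero , refl
∣p∣>0⇒∃inside (outside ∷ p) 0<∣p∣ with ∣p∣>0⇒∃inside p 0<∣p∣
... | i , i∈p = suc i , i∈p

module _ (G : Graph n) where

  lookup-N-self : ∀ v → lookup (N G v) v ≡ outside
  lookup-N-self v = trans (lookup∘tabulate _ v) (⌊⌋-false (adj? G v v) (irrefl G))

  N-∋ : ∀ {v w} → Adj G v w → lookup (N G v) w ≡ inside
  N-∋ {v} {w} vw = trans (lookup∘tabulate _ w) (⌊⌋-true (adj? G v w) vw)

  N[]-∋ : ∀ {v w} → w ≡ v ⊎ Adj G v w → lookup (N[ G ] v) w ≡ inside
  N[]-∋ {v} {w} w≡v⊎vw = trans (lookup∘tabulate (λ x → ⌊ x ≟ v ⌋ ∨ ⌊ adj? G v x ⌋) w) (helper w≡v⊎vw)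
    where
    helper : w ≡ v ⊎ Adj G v w → ⌊ w ≟ v ⌋ ∨ ⌊ adj? G v w ⌋ ≡ true
    helper (inj₁ w≡v) rewrite ⌊⌋-true (w ≟ v) w≡v = refl
    helper (inj₂ vw)  rewrite ⌊⌋-true (adj? G v w) vw = ∨-zeroʳ _

module _ (G : Graph (suc n)) where

  deg≤ : ∀ v → deg G v ≤ n
  deg≤ v = begin
    ∣ N G v ∣                                 ≡⟨ ∣p∣≡∣p[i]∷removeAt∣ (N G v) v ⟩
    ∣ lookup (N G v) v ∷ removeAt (N G v) v ∣ ≡⟨ cong (λ x → ∣ x ∷ removeAt (N G v) v ∣) (lookup-N-self G v) ⟩
    ∣ removeAt (N G v) v ∣                    ≤⟨ ∣p∣≤n (removeAt (N G v) v) ⟩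
    n                                         ∎
    where open ≤-Reasoning

  dom-size : ∀ D → IsKTupleDom G k D → k ≤ ∣ D ∣
  dom-size D dom = ≤-trans (dom zero) (∣p∩q∣≤∣q∣ (N[ G ] zero) D)

  dom-drop : ∀ D i → IsKTupleDom G (suc k) D → IsKTupleDom G k (D [ i ]≔ outside)
  dom-drop D i dom v =
    ≤-pred (≤-trans (dom v) (removeAt-≡⇒∣p∣≤1+∣q∣ (N[ G ] v ∩ D) (N[ G ] v ∩ (D [ i ]≔ outside)) i agree))
    where
    agree : removeAt (N[ G ] v ∩ D) i ≡ removeAt (N[ G ] v ∩ (D [ i ]≔ outside)) i
    agree = begin
      removeAt (N[ G ] v ∩ D) i                             ≡⟨ removeAt-zipWith _∧_ (N[ G ] v) D i ⟩
      removeAt (N[ G ] v) i ∩ removeAt D i                  ≡⟨ cong (removeAt (N[ G ] v) i ∩_) (removeAt-[]≔ D i outside) ⟨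
      removeAt (N[ G ] v) i ∩ removeAt (D [ i ]≔ outside) i ≡⟨ removeAt-zipWith _∧_ (N[ G ] v) (D [ i ]≔ outside) i ⟨
      removeAt (N[ G ] v ∩ (D [ i ]≔ outside)) i            ∎
      where open ≡-Reasoning

  module _ (u : Fin (suc n)) (i : Fin n) where

    removeAt-N : removeAt (N G (punchIn u i)) u ≡ N (G ─ u) i
    removeAt-N = removeAt-tabulate (λ w → ⌊ adj? G (punchIn u i) w ⌋) u

    removeAt-N[] : removeAt (N[ G ] (punchIn u i)) u ≡ N[ G ─ u ] i
    removeAt-N[] =
      trans (removeAt-tabulate (λ w → ⌊ w ≟ punchIn u i ⌋ ∨ ⌊ adj? G (punchIn u i) w ⌋) u) (tabulate-cong λ j →
      cong (_∨ ⌊ adj? G (punchIn u i) (punchIn u j) ⌋)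
           (⌊⌋-⇔ (mk⇔ (punchIn-injective u j i) (cong (punchIn u))) (punchIn u j ≟ punchIn u i) (j ≟ i)))

module UniversalVertex (G : Graph (suc (suc n))) (u : Fin (suc (suc n))) (univ : Universal G u) where

  H : Graph (suc n)
  H = G ─ u

  u-adj : ∀ v → v ≡ u ⊎ Adj G u v
  u-adj v with v ≟ u
  ... | yes v≡u = inj₁ v≡u
  ... | no  v≢u = inj₂ (univ v v≢u)

  u∈N[] : ∀ v → lookup (N[ G ] v) u ≡ inside
  u∈N[] v = N[]-∋ G (map sym (Graph.sym G) (u-adj v))

  N[u]≡⊤ : N[ G ] u ≡ ⊤
  N[u]≡⊤ = lookup-ext _ _ λ w → trans (N[]-∋ G (u-adj w)) (sym (lookup-replicate w inside))

  ∣N[u]∩D∣≡∣D∣ : ∀ D → ∣ N[ G ] u ∩ D ∣ ≡ ∣ D ∣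
  ∣N[u]∩D∣≡∣D∣ D = trans (cong (∣_∣ ∘ (_∩ D)) N[u]≡⊤) (cong ∣_∣ (∩-identityˡ D))

  ∣N[punchIn]∩D∣ : ∀ i D → ∣ N[ G ] (punchIn u i) ∩ D ∣ ≡ ∣ lookup D u ∷ N[ H ] i ∩ removeAt D u ∣
  ∣N[punchIn]∩D∣ i D = begin
    ∣ N[ G ] v ∩ D ∣                                        ≡⟨ ∣p∣≡∣p[i]∷removeAt∣ (N[ G ] v ∩ D) u ⟩
    ∣ lookup (N[ G ] v ∩ D) u ∷ removeAt (N[ G ] v ∩ D) u ∣ ≡⟨ cong₂ (λ x p → ∣ x ∷ p ∣) lookup-N[v]∩D removeAt-N[v]∩D ⟩
    ∣ lookup D u ∷ N[ H ] i ∩ removeAt D u ∣                ∎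
    where
    open ≡-Reasoning
    v = punchIn u i
    lookup-N[v]∩D : lookup (N[ G ] v ∩ D) u ≡ lookup D u
    lookup-N[v]∩D = trans (lookup-zipWith _∧_ u (N[ G ] v) D) (cong (_∧ lookup D u) (u∈N[] v))
    removeAt-N[v]∩D : removeAt (N[ G ] v ∩ D) u ≡ N[ H ] i ∩ removeAt D u
    removeAt-N[v]∩D = trans (removeAt-zipWith _∧_ (N[ G ] v) D u) (cong (_∩ removeAt D u) (removeAt-N[] G u i))

  deg-punchIn : ∀ i → deg G (punchIn u i) ≡ suc (deg H i)
  deg-punchIn i = begin
    ∣ N G v ∣                                 ≡⟨ ∣p∣≡∣p[i]∷removeAt∣ (N G v) u ⟩
    ∣ lookup (N G v) u ∷ removeAt (N G v) u ∣ ≡⟨ cong₂ (λ x p → ∣ x ∷ p ∣) v∼u (removeAt-N G u i) ⟩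
    suc ∣ N H i ∣                             ∎
    where
    open ≡-Reasoning
    v = punchIn u i
    v∼u : lookup (N G v) u ≡ inside
    v∼u = N-∋ G (Graph.sym G (univ v (punchInᵢ≢i u i)))

  deg-u : deg G u ≡ suc n
  deg-u = begin
    ∣ N G u ∣                                 ≡⟨ ∣p∣≡∣p[i]∷removeAt∣ (N G u) u ⟩
    ∣ lookup (N G u) u ∷ removeAt (N G u) u ∣ ≡⟨ cong₂ (λ x p → ∣ x ∷ p ∣) (lookup-N-self G u) removeAt-N[u]≡⊤ ⟩
    ∣ ⊤ {suc n} ∣                             ≡⟨ ∣⊤∣≡n (suc n) ⟩
    suc n                                     ∎
    where
    open ≡-Reasoning
    removeAt-N[u]≡⊤ : removeAt (N G u) u ≡ ⊤
    removeAt-N[u]≡⊤ = lookup-ext _ _ λ j → begin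
      lookup (removeAt (N G u) u) j ≡⟨ lookup-removeAt (N G u) u j ⟩
      lookup (N G u) (punchIn u j)  ≡⟨ N-∋ G (univ (punchIn u j) (punchInᵢ≢i u j)) ⟩
      inside                        ≡⟨ lookup-replicate j inside ⟨
      lookup ⊤ j                    ∎

  admissible⇒admissible-─ : Admissible G (suc k) → Admissible H k
  admissible⇒admissible-─ adm i = ≤-pred (subst (λ d → _ ≤ suc d) (deg-punchIn i) (adm (punchIn u i)))

  admissible-─⇒admissible : Admissible H k → Admissible G (suc k)
  admissible-─⇒admissible {k} adm = punchIn-elim u at-u at-punchIn
    where
    at-u : suc k ≤ suc (deg G u)
    at-u = subst (λ d → suc k ≤ suc d) (sym deg-u) (s≤s (≤-trans (adm zero) (s≤s (deg≤ H zero))))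
    at-punchIn : ∀ i → suc k ≤ suc (deg G (punchIn u i))
    at-punchIn i = subst (λ d → suc k ≤ suc d) (sym (deg-punchIn i)) (s≤s (adm i))

  dom-insertAt : ∀ D → IsKTupleDom H k D → IsKTupleDom G (suc k) (insertAt D u inside)
  dom-insertAt {k} D dom = punchIn-elim u at-u at-punchIn
    where
    D⁺ = insertAt D u inside
    at-u : suc k ≤ ∣ N[ G ] u ∩ D⁺ ∣
    at-u = subst (suc k ≤_) (sym (trans (∣N[u]∩D∣≡∣D∣ D⁺) (∣insertAt∣ D u inside))) (s≤s (dom-size H D dom))
    at-punchIn : ∀ i → suc k ≤ ∣ N[ G ] (punchIn u i) ∩ D⁺ ∣
    at-punchIn i = subst (suc k ≤_) (sym (trans (∣N[punchIn]∩D∣ i D⁺)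
                     (cong₂ (λ x p → ∣ x ∷ N[ H ] i ∩ p ∣) (insertAt-lookup D u inside) (removeAt-insertAt D u inside))))
                     (s≤s (dom i))

  dom-removeAt : ∀ D → IsKTupleDom G (suc k) D → ∃ λ D′ → IsKTupleDom H k D′ × suc ∣ D′ ∣ ≤ ∣ D ∣
  dom-removeAt {k} D dom = peel (lookup D u) (∣p∣≡∣p[i]∷removeAt∣ D u)
                               (λ i → subst (suc k ≤_) (∣N[punchIn]∩D∣ i D) (dom (punchIn u i)))
    where
    D₀ = removeAt D u
    peel : ∀ x → ∣ D ∣ ≡ ∣ x ∷ D₀ ∣ → (∀ i → suc k ≤ ∣ x ∷ N[ H ] i ∩ D₀ ∣) →
           ∃ λ D′ → IsKTupleDom H k D′ × suc ∣ D′ ∣ ≤ ∣ D ∣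
    peel inside  ∣D∣≡ dom₀ = D₀ , (λ i → ≤-pred (dom₀ i)) , ≤-reflexive (sym ∣D∣≡)
    peel outside ∣D∣≡ dom₀ with ∣p∣>0⇒∃inside D₀ (≤-trans (s≤s z≤n) (dom-size H D₀ dom₀))
    ... | j , j∈D₀ =
      D₀ [ j ]≔ outside , dom-drop H D₀ j dom₀ , ≤-reflexive (sym (trans ∣D∣≡ (∣p∣≡1+∣p[i]≔outside∣ D₀ j∈D₀)))

minBy : (A → ℕ) → ℕ → List A → ℕ
minBy f = foldr (λ x m → f x ⊓ m)

minBy-≤-default : ∀ (f : A → ℕ) c xs → minBy f c xs ≤ c
minBy-≤-default f c []       = ≤-refl
minBy-≤-default f c (x ∷ xs) = ≤-trans (m⊓n≤n (f x) _) (minBy-≤-default f c xs)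

minBy-≤-∈ : ∀ (f : A → ℕ) c {xs x} → x ∈ xs → minBy f c xs ≤ f x
minBy-≤-∈ f c {x ∷ xs} (here refl) = m⊓n≤m (f x) _
minBy-≤-∈ f c {y ∷ xs} (there x∈xs) = ≤-trans (m⊓n≤n (f y) _) (minBy-≤-∈ f c x∈xs)

minBy-attained : ∀ (f : A → ℕ) c xs → minBy f c xs ≡ c ⊎ ∃ λ x → x ∈ xs × minBy f c xs ≡ f x
minBy-attained f c []       = inj₁ refl
minBy-attained f c (x ∷ xs) with ⊓-sel (f x) (minBy f c xs) | minBy-attained f c xs
... | inj₁ eq | _                    = inj₂ (x , here refl , eq)
... | inj₂ eq | inj₁ eq′             = inj₁ (trans eq eq′)
... | inj₂ eq | inj₂ (y , y∈xs , eq′) = inj₂ (y , there y∈xs , trans eq eq′)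

∈-subsets : ∀ n (D : Subset n) → D ∈ subsets n
∈-subsets zero    []            = here refl
∈-subsets (suc n) (outside ∷ D) = ∈-++⁺ˡ (∈-map⁺ (outside ∷_) (∈-subsets n D))
∈-subsets (suc n) (inside  ∷ D) = ∈-++⁺ʳ _ (∈-map⁺ (inside ∷_) (∈-subsets n D))

module _ (G : Graph (suc n)) (k : ℕ) where

  dominating : List (Subset (suc n))
  dominating = filter (isKTupleDom? G k) (subsets (suc n))

  γ : ℕ
  γ = minBy ∣_∣ (suc n) dominating

  γ≤1+n : γ ≤ suc n
  γ≤1+n = minBy-≤-default ∣_∣ (suc n) dominating

  γ≤∣D∣ : ∀ D → IsKTupleDom G k D → γ ≤ ∣ D ∣
  γ≤∣D∣ D dom = minBy-≤-∈ ∣_∣ (suc n) (∈-filter⁺ (isKTupleDom? G k) (∈-subsets (suc n) D) dom)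

  γ-attained : γ ≡ suc n ⊎ ∃ λ D → IsKTupleDom G k D × γ ≡ ∣ D ∣
  γ-attained with minBy-attained ∣_∣ (suc n) dominating
  ... | inj₁ eq             = inj₁ eq
  ... | inj₂ (D , D∈ , eq) = inj₂ (D , proj₂ (∈-filter⁻ (isKTupleDom? G k) {xs = subsets (suc n)} D∈) , eq)

  γ×-admissible : Admissible G k → γ× G k ≡ just γ
  γ×-admissible adm with all? (λ v → k ≤? suc (deg G v))
  ... | yes _   = refl
  ... | no ¬adm = ⊥-elim (¬adm adm)

  γ×-inadmissible : ¬ Admissible G k → γ× G k ≡ nothing
  γ×-inadmissible ¬adm with all? (λ v → k ≤? suc (deg G v))
  ... | yes adm = ⊥-elim (¬adm adm)
  ... | no _    = refl

k≤γ : ∀ (G : Graph (suc n)) k → k ≤ suc n → k ≤ γ G k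
k≤γ G k k≤1+n with γ-attained G k
... | inj₁ γ≡1+n         = subst (k ≤_) (sym γ≡1+n) k≤1+n
... | inj₂ (D , dom , γ≡∣D∣) = subst (k ≤_) (sym γ≡∣D∣) (dom-size G D dom)

module _ {k l : ℕ} (G : Graph (suc (suc n))) (H : Graph (suc n)) where

  γ-suc : (∀ D → IsKTupleDom H l D → ∃ λ D⁺ → IsKTupleDom G k D⁺ × ∣ D⁺ ∣ ≤ suc ∣ D ∣) →
          (∀ D → IsKTupleDom G k D → ∃ λ D⁻ → IsKTupleDom H l D⁻ × suc ∣ D⁻ ∣ ≤ ∣ D ∣) →
          γ G k ≡ suc (γ H l)
  γ-suc lift lower = ≤-antisym γG≤1+γH 1+γH≤γG
    where
    γG≤1+γH : γ G k ≤ suc (γ H l)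
    γG≤1+γH with γ-attained H l
    ... | inj₁ γH≡1+n = subst (λ x → γ G k ≤ suc x) (sym γH≡1+n) (γ≤1+n G k)
    ... | inj₂ (D , dom , γH≡∣D∣) with lift D dom
    ... | D⁺ , dom⁺ , ∣D⁺∣≤ =
      subst (λ x → γ G k ≤ suc x) (sym γH≡∣D∣) (≤-trans (γ≤∣D∣ G k D⁺ dom⁺) ∣D⁺∣≤)
    1+γH≤γG : suc (γ H l) ≤ γ G k
    1+γH≤γG with γ-attained G k
    ... | inj₁ γG≡2+n = subst (suc (γ H l) ≤_) (sym γG≡2+n) (s≤s (γ≤1+n H l))
    ... | inj₂ (D , dom , γG≡∣D∣) with lower D dom
    ... | D⁻ , dom⁻ , ∣D⁻∣< =
      subst (suc (γ H l) ≤_) (sym γG≡∣D∣) (≤-trans (s≤s (γ≤∣D∣ H l D⁻ dom⁻)) ∣D⁻∣<)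

γ×-suc : ∀ {k l} (G : Graph (suc m)) (H : Graph (suc n)) →
         (Admissible G k → Admissible H l) → (Admissible H l → Admissible G k) →
         γ G k ≡ suc (γ H l) → γ× G k ≡ γ× H l +∞1
γ×-suc {k = k} {l} G H to from γG≡1+γH = by-cases (all? (λ v → k ≤? suc (deg G v)))
  where
  by-cases : Dec (Admissible G k) → γ× G k ≡ γ× H l +∞1
  by-cases (yes adm) = begin
    γ× G k           ≡⟨ γ×-admissible G k adm ⟩
    just (γ G k)     ≡⟨ cong just γG≡1+γH ⟩
    just (γ H l) +∞1 ≡⟨ cong _+∞1 (γ×-admissible H l (to adm)) ⟨
    γ× H l +∞1       ∎
    where open ≡-Reasoning
  by-cases (no ¬adm) = trans (γ×-inadmissible G k ¬adm) (sym (cong _+∞1 (γ×-inadmissible H l (¬adm ∘ from))))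

γ×-K₁ : ∀ (G : Graph 1) u k → γ× G (suc k) ≡ γ× (G ─ u) k +∞1
γ×-K₁ G u zero    =
  trans (γ×-admissible G 1 (λ _ → s≤s z≤n)) (cong just (≤-antisym (γ≤1+n G 1) (k≤γ G 1 ≤-refl)))
γ×-K₁ G u (suc k) = γ×-inadmissible G (suc (suc k)) λ adm → n≮0 (≤-trans (≤-pred (adm zero)) (deg≤ G zero))

proposition1 : ∀ {n} (G : Graph (suc n)) (u : Fin (suc n)) → Universal G u →
    (k : ℕ) → 1 ≤ k → γ× G k ≡ (γ× (G ─ u) (k ∸ 1)) +∞1
proposition1 {zero}  G u univ (suc k) _ = γ×-K₁ G u k
proposition1 {suc n} G u univ (suc k) _ =
  γ×-suc G H admissible⇒admissible-─ admissible-─⇒admissible (γ-suc G H lift dom-removeAt)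
  where
  open UniversalVertex G u univ
  lift : ∀ D → IsKTupleDom H k D → ∃ λ D⁺ → IsKTupleDom G (suc k) D⁺ × ∣ D⁺ ∣ ≤ suc ∣ D ∣
  lift D dom = insertAt D u inside , dom-insertAt D dom , ≤-reflexive (∣insertAt∣ D u inside)
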